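{- Let $W=I_2(k)$ be the dihedral group of order $2k$. Then $$\operatorname{Cat}^{(1)}(W;q,t)=[k+1]_{q,t}+qt=q^k+q^{k-1}t+\dots+qt^{k-1}+t^k+qt.$$
   Context: $I_2(k)$ acts on $V=\mathbb{C}^2$ as the complexification of its real reflection representation, and diagonally (identically) on the variables $\mathbf{x}=(x_1,x_2)$, $\mathbf{y}=(y_1,y_2)$ of $\mathbb{C}[\mathbf{x},\mathbf{y}]$. A polynomial $p$ is determinantal if $\omega(p)=\det(\omega)p$ for all $\omega\in W$; $\mathcal{A}$ is the ideal generated by all determinantal polynomials and $\langle\mathbf{x},\mathbf{y}\rangle$ the ideal generated by all variables. For $m\ge0$, $\operatorname{Cat}^{(m)}(W;q,t):=\sum_{i,j}\dim\big((\mathcal{A}^m/\langle\mathbf{x},\mathbf{y}\rangle\mathcal{A}^m)_{i,j}\big)q^it^j$, where $(i,j)$ is the bidegree ($\mathbf{x}$-degree, $\mathbf{y}$-degree). $[n]_{q,t}=\frac{q^n-t^n}{q-t}=q^{n-1}+q^{n-2}t+\dots+t^{n-1}$. -}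

module Defs where

open import Level using (Level; _⊔_)
open import Algebra.Bundles using (CommutativeRing)
open import Data.Nat using (ℕ; zero; suc; _+_; _*_; _∸_; _<_; _≡ᵇ_)
open import Data.Bool using (Bool; true; false; if_then_else_; _∧_)
open import Data.Fin using (Fin)
import Data.Fin
open import Data.Product using (Σ; ∃; _×_; _,_)
open import Relation.Binary.PropositionalEquality using (_≡_)
open import Relation.Nullary using (¬_)

-- Exponent vectors of monomials  z₁^a₁ z₂^a₂ w₁^b₁ w₂^b₂
-- (z₁,z₂ : coordinates of the x-copy of V, w₁,w₂ : of the y-copy),
-- written in an eigenbasis of the rotation subgroup.

record Exp : Set where
  constructor exp
  field
    a₁ a₂ b₁ b₂ : ℕ
open Exp public

xdeg ydeg tdeg : Exp → ℕ
xdeg e = a₁ e + a₂ e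
ydeg e = b₁ e + b₂ e
tdeg e = xdeg e + ydeg e

-- the coefficient 1 when i + j = k, plus 1 when (i,j) = (1,1):
-- coefficient of q^i t^j in [k+1]_{q,t} + q t
catCoeff : ℕ → ℕ → ℕ → ℕ
catCoeff k i j =
  (if (i + j) ≡ᵇ k then 1 else 0) + (if (i ≡ᵇ 1) ∧ (j ≡ᵇ 1) then 1 else 0)

module Over {c ℓ : Level} (R : CommutativeRing c ℓ) where
  open CommutativeRing R renaming (Carrier to K; _*_ to _·_; _+_ to _⊕_; -_ to ⊖_; _-_ to _⊝_)

  pow : K → ℕ → K
  pow x zero    = 1#
  pow x (suc n) = x · pow x n

  natK : ℕ → K
  natK zero    = 0#
  natK (suc n) = 1# ⊕ natK n

  IsField : Set (c ⊔ ℓ)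
  IsField = (¬ (1# ≈ 0#)) × (∀ x → ¬ (x ≈ 0#) → ∃ λ y → (x · y) ≈ 1#)

  CharZero : Set ℓ
  CharZero = ∀ n → natK n ≈ 0# → n ≡ 0

  PrimitiveRoot : ℕ → K → Set ℓ
  PrimitiveRoot k ζ = (pow ζ k ≈ 1#) × (∀ m → 0 < m → m < k → ¬ (pow ζ m ≈ 1#))

  sumTo : ℕ → (ℕ → K) → K
  sumTo zero    f = f 0
  sumTo (suc n) f = sumTo n f ⊕ f (suc n)

  sumFin : (n : ℕ) → (Fin n → K) → K
  sumFin zero    f = 0#
  sumFin (suc n) f = f Fin.zero ⊕ sumFin n (λ l → f (Fin.suc l))

  -- Polynomials in K[z₁,z₂,w₁,w₂] as coefficient functions with finite support

  Fun : Set c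
  Fun = Exp → K

  Finite : Fun → Set ℓ
  Finite p = ∃ λ N → ∀ e → N < tdeg e → p e ≈ 0#

  _⋆_ : Fun → Fun → Fun
  (p ⋆ q) e =
    sumTo (a₁ e) λ i₁ → sumTo (a₂ e) λ i₂ → sumTo (b₁ e) λ j₁ → sumTo (b₂ e) λ j₂ →
      p (exp i₁ i₂ j₁ j₂) · q (exp (a₁ e ∸ i₁) (a₂ e ∸ i₂) (b₁ e ∸ j₁) (b₂ e ∸ j₂))

  Bihom : ℕ → ℕ → Fun → Set ℓ
  Bihom i j p = ∀ e → ¬ (xdeg e ≡ i × ydeg e ≡ j) → p e ≈ 0#

  -- In the eigen-coordinates, ρ (rotation by 2π/k) scales
  -- z₁,w₁ by ζ and z₂,w₂ by ζ⁻¹ = ζ^(k-1); τ (a reflection) swaps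
  -- z₁ ↔ z₂ and w₁ ↔ w₂.  det ρˡ = 1, det (ρˡ τ) = -1.

  data Dih (k : ℕ) : Set where
    rot  : Fin k → Dih k
    rfl : Fin k → Dih k

  swapE : Exp → Exp
  swapE e = exp (a₂ e) (a₁ e) (b₂ e) (b₁ e)

  rotAct : ℕ → K → ℕ → Fun → Fun
  rotAct k ζ l p e =
    pow ζ (l * (a₁ e + b₁ e) + l * (k ∸ 1) * (a₂ e + b₂ e)) · p e

  reflAct : Fun → Fun
  reflAct p e = p (swapE e)

  act : (k : ℕ) → K → Dih k → Fun → Fun
  act k ζ (rot l)  p = rotAct k ζ (Data.Fin.toℕ l) p
  act k ζ (rfl l) p = rotAct k ζ (Data.Fin.toℕ l) (reflAct p)

  det : {k : ℕ} → Dih k → K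
  det (rot l)  = 1#
  det (rfl l) = ⊖ 1#

  Determinantal : (k : ℕ) → K → Fun → Set ℓ
  Determinantal k ζ p = Finite p × (∀ (ω : Dih k) e → act k ζ ω p e ≈ (det ω · p e))

  InA : (k : ℕ) → K → Fun → Set (c ⊔ ℓ)
  InA k ζ p = Σ ℕ λ n → Σ (Fin n → Fun) λ f → Σ (Fin n → Fun) λ d →
    (∀ l → Finite (f l)) × (∀ l → Determinantal k ζ (d l)) ×
    (∀ e → p e ≈ sumFin n (λ l → (f l ⋆ d l) e))

  InXY : Fun → Set ℓ
  InXY g = Finite g × (g (exp 0 0 0 0) ≈ 0#)

  InXYA : (k : ℕ) → K → Fun → Set (c ⊔ ℓ)
  InXYA k ζ p = Σ ℕ λ n → Σ (Fin n → Fun) λ g → Σ (Fin n → Fun) λ a →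
    (∀ l → InXY (g l)) × (∀ l → InA k ζ (a l)) ×
    (∀ e → p e ≈ sumFin n (λ l → (g l ⋆ a l) e))

  -- dimension of a quotient U/V of subspaces (given as predicates on Fun):
  -- U/V has dimension r iff there are u₁…u_r ∈ U whose classes form a basis
  -- of U/V.

  lincomb : (r : ℕ) → (Fin r → K) → (Fin r → Fun) → Fun
  lincomb r cs us e = sumFin r (λ l → cs l · us l e)

  QuotDim : ∀ {u v} → (Fun → Set u) → (Fun → Set v) → ℕ → Set (c ⊔ ℓ ⊔ u ⊔ v)
  QuotDim U V r = Σ (Fin r → Fun) λ us →
    (∀ l → U (us l)) ×
    (∀ (cs : Fin r → K) → V (lincomb r cs us) → ∀ l → cs l ≈ 0#) ×
    (∀ p → U p → ∃ λ (cs : Fin r → K) → V (λ e → p e ⊝ lincomb r cs us e))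

  A-comp : (k : ℕ) → K → ℕ → ℕ → Fun → Set (c ⊔ ℓ)
  A-comp k ζ i j p = InA k ζ p × Bihom i j p

  XYA-comp : (k : ℕ) → K → ℕ → ℕ → Fun → Set (c ⊔ ℓ)
  XYA-comp k ζ i j p = InXYA k ζ p × Bihom i j p

  -- coefficient of q^i t^j in Cat^{(1)}(I₂(k); q, t):
  -- dim (𝒜 / ⟨x,y⟩𝒜)_{i,j} = r
  CatCoeffIs : (k : ℕ) → K → ℕ → ℕ → ℕ → Set (c ⊔ ℓ)
  CatCoeffIs k ζ i j r = QuotDim (A-comp k ζ i j) (XYA-comp k ζ i j) r

-- In coordinates z₁, z₂ (for x) and w₁, w₂ (for y) diagonalising the rotation ρ, the monomial m_s with
-- exponent s is scaled by ζ ^ wt s, where wt s ≡ (a₁ + b₁) - (a₂ + b₂) (mod k), and a reflection swaps the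
-- indices.  So a determinantal polynomial is a combination of alternants Alt s = m_s - m_(swap s) with k ∣ wt s
-- (dividing by 2 uses characteristic 0), and projecting f ⋆ d (d determinantal) to bidegree (i, j) shows
-- that every element of 𝒜 of that bidegree is congruent modulo ⟨x,y⟩𝒜 to such a combination.
-- If s and t are nonzero with k ∣ wt s and k ∣ wt t, then Alt (s + t) = m_s · Alt t + m_(swap t) · Alt s lies
-- in ⟨x,y⟩𝒜.  The exponents that do not split like this and are not swap-symmetric are, up to swapping,
-- z₁^a w₁^b with a + b = k and z₁ w₂: this gives the spanning set.  It is independent because an element of
-- ⟨x,y⟩𝒜 vanishes at each of these exponents, every smaller exponent being 0 or of weight not divisible by k,
-- where all determinantal polynomials vanish.  Of bidegree (i, j) there is one exponent of the first kind iff
-- i + j = k and one of the second kind iff i = j = 1.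

module Submission where

open import Defs
open import Level using (Level; _⊔_)
open import Algebra.Bundles using (CommutativeRing)
open import Data.Nat using (ℕ; zero; suc; _+_; _*_; _∸_; _≤_; _<_; z≤n; s≤s; _≟_; _≤?_; ≢-nonZero)
import Data.Nat.Properties as ℕ
import Algebra.Properties.CommutativeSemigroup ℕ.+-commutativeSemigroup as ℕ+
open import Data.Nat.DivMod using (_%_; _/_; m%n<n; m≡m%n+[m/n]*n)
open import Data.Nat.Divisibility using (_∣_; _∣?_; divides; ∣m+n∣m⇒∣n; ∣n⇒∣m*n; m%n≡0⇒n∣m; n∣n; ∣⇒≤)
open import Data.Nat.Tactic.RingSolver using (solve-∀)
open import Data.Bool using (Bool; true; false; if_then_else_)
open import Data.Fin using (Fin; splitAt; toℕ)
import Data.Fin.Properties as Finₚ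
open import Data.Vec.Functional using (Vector; _++_; tail; zipWith)
open import Data.Vec.Functional.Relation.Unary.All.Properties using (++⁺)
open import Data.Sum using (_⊎_; inj₁; inj₂)
open import Data.Product using (∃; ∃₂; _×_; _,_; proj₁; proj₂)
open import Data.Empty using (⊥-elim)
open import Function using (_∘_)
open import Relation.Nullary using (¬_; Dec; yes; no; does; proof)
open import Relation.Nullary.Reflects using (Reflects; ofʸ; ofⁿ; _×-reflects_)
open import Relation.Nullary.Decidable using (_×-dec_; map′; dec-true; dec-false)
open import Relation.Binary.PropositionalEquality as ≡ using (_≡_; _≢_; _≗_)

infix  4 _≤ₑ_ _≤ₑ?_ _≟ₑ_
infixl 6 _+ₑ_ _∸ₑ_

0ₑ : Exp
0ₑ = exp 0 0 0 0

_+ₑ_ _∸ₑ_ : Exp → Exp → Exp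
s +ₑ t = exp (a₁ s + a₁ t) (a₂ s + a₂ t) (b₁ s + b₁ t) (b₂ s + b₂ t)
s ∸ₑ t = exp (a₁ s ∸ a₁ t) (a₂ s ∸ a₂ t) (b₁ s ∸ b₁ t) (b₂ s ∸ b₂ t)

_≤ₑ_ : Exp → Exp → Set
s ≤ₑ t = a₁ s ≤ a₁ t × a₂ s ≤ a₂ t × b₁ s ≤ b₁ t × b₂ s ≤ b₂ t

_≤ₑ?_ : (s t : Exp) → Dec (s ≤ₑ t)
s ≤ₑ? t = a₁ s ≤? a₁ t ×-dec a₂ s ≤? a₂ t ×-dec b₁ s ≤? b₁ t ×-dec b₂ s ≤? b₂ t

exp-cong : ∀ {a b c d a′ b′ c′ d′} → a ≡ a′ → b ≡ b′ → c ≡ c′ → d ≡ d′ →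
           exp a b c d ≡ exp a′ b′ c′ d′
exp-cong ≡.refl ≡.refl ≡.refl ≡.refl = ≡.refl

_≟ₑ_ : (s t : Exp) → Dec (s ≡ t)
s ≟ₑ t = map′ (λ (p , q , r , u) → exp-cong p q r u)
              (λ s≡t → ≡.cong a₁ s≡t , ≡.cong a₂ s≡t , ≡.cong b₁ s≡t , ≡.cong b₂ s≡t)
              (a₁ s ≟ a₁ t ×-dec a₂ s ≟ a₂ t ×-dec b₁ s ≟ b₁ t ×-dec b₂ s ≟ b₂ t)

≤ₑ-trans : ∀ {s t u} → s ≤ₑ t → t ≤ₑ u → s ≤ₑ u
≤ₑ-trans (p , q , r , u) (p′ , q′ , r′ , u′) =
  ℕ.≤-trans p p′ , ℕ.≤-trans q q′ , ℕ.≤-trans r r′ , ℕ.≤-trans u u′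

0ₑ-≤ₑ : ∀ s → 0ₑ ≤ₑ s
0ₑ-≤ₑ s = z≤n , z≤n , z≤n , z≤n

≤ₑ-+ₑ : ∀ s t → s ≤ₑ s +ₑ t
≤ₑ-+ₑ s t = ℕ.m≤m+n (a₁ s) (a₁ t) , ℕ.m≤m+n (a₂ s) (a₂ t) , ℕ.m≤m+n (b₁ s) (b₁ t) , ℕ.m≤m+n (b₂ s) (b₂ t)

∸ₑ-≤ₑ : ∀ s t → s ∸ₑ t ≤ₑ s
∸ₑ-≤ₑ s t = ℕ.m∸n≤m (a₁ s) (a₁ t) , ℕ.m∸n≤m (a₂ s) (a₂ t) , ℕ.m∸n≤m (b₁ s) (b₁ t) , ℕ.m∸n≤m (b₂ s) (b₂ t)

+ₑ-comm : ∀ s t → s +ₑ t ≡ t +ₑ s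
+ₑ-comm s t = exp-cong (ℕ.+-comm (a₁ s) (a₁ t)) (ℕ.+-comm (a₂ s) (a₂ t))
                       (ℕ.+-comm (b₁ s) (b₁ t)) (ℕ.+-comm (b₂ s) (b₂ t))

+ₑ-identityʳ : ∀ s → s +ₑ 0ₑ ≡ s
+ₑ-identityʳ s = exp-cong (ℕ.+-identityʳ (a₁ s)) (ℕ.+-identityʳ (a₂ s)) (ℕ.+-identityʳ (b₁ s)) (ℕ.+-identityʳ (b₂ s))

+ₑ-∸ₑ : ∀ {s t} → s ≤ₑ t → s +ₑ (t ∸ₑ s) ≡ t
+ₑ-∸ₑ (p , q , r , u) = exp-cong (ℕ.m+[n∸m]≡n p) (ℕ.m+[n∸m]≡n q) (ℕ.m+[n∸m]≡n r) (ℕ.m+[n∸m]≡n u)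

+ₑ-∸ₑ-cancel : ∀ s t → (s +ₑ t) ∸ₑ s ≡ t
+ₑ-∸ₑ-cancel s t = exp-cong (ℕ.m+n∸m≡n (a₁ s) (a₁ t)) (ℕ.m+n∸m≡n (a₂ s) (a₂ t))
                            (ℕ.m+n∸m≡n (b₁ s) (b₁ t)) (ℕ.m+n∸m≡n (b₂ s) (b₂ t))

≤ₑ-∸ₑ⇒0ₑ : ∀ {s t} → s ≤ₑ t → t ≤ₑ t ∸ₑ s → s ≡ 0ₑ
≤ₑ-∸ₑ⇒0ₑ (p , q , r , u) (p′ , q′ , r′ , u′) = exp-cong (lemma p p′) (lemma q q′) (lemma r r′) (lemma u u′)
  where
  lemma : ∀ {m n} → m ≤ n → n ≤ n ∸ m → m ≡ 0
  lemma {zero}              _       _ = ≡.refl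
  lemma {suc m} {suc n} (s≤s _) n≤n∸m = ⊥-elim (ℕ.1+n≰n (ℕ.≤-trans n≤n∸m (ℕ.m∸n≤m n m)))

xdeg-+ₑ : ∀ s t → xdeg (s +ₑ t) ≡ xdeg s + xdeg t
xdeg-+ₑ s t = ℕ+.interchange (a₁ s) (a₁ t) (a₂ s) (a₂ t)

ydeg-+ₑ : ∀ s t → ydeg (s +ₑ t) ≡ ydeg s + ydeg t
ydeg-+ₑ s t = ℕ+.interchange (b₁ s) (b₁ t) (b₂ s) (b₂ t)

≤-+-split : ∀ {n} a b → n ≤ a + b → ∃₂ λ a′ b′ → a′ ≤ a × b′ ≤ b × a′ + b′ ≡ n
≤-+-split {n} a b n≤a+b with n ≤? a
... | yes n≤a = n , 0 , n≤a , z≤n , ℕ.+-identityʳ n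
... | no  n≰a = a , n ∸ a , ℕ.≤-refl , ℕ.m≤n+o⇒m∸n≤o n a n≤a+b , ℕ.m+[n∸m]≡n (ℕ.<⇒≤ (ℕ.≰⇒> n≰a))

tail-++ : ∀ {a} {A : Set a} {m n} (xs : Vector A (suc m)) (ys : Vector A n) → tail (xs ++ ys) ≗ tail xs ++ ys
tail-++ {m = m} xs ys l with splitAt m l
... | inj₁ _ = ≡.refl
... | inj₂ _ = ≡.refl

zipWith-++ : ∀ {a b c} {A : Set a} {B : Set b} {C : Set c} {m n} (f : A → B → C)
             (xs : Vector A m) (xs′ : Vector A n) (ys : Vector B m) (ys′ : Vector B n) →
             zipWith f (xs ++ xs′) (ys ++ ys′) ≗ zipWith f xs ys ++ zipWith f xs′ ys′
zipWith-++ {m = m} f xs xs′ ys ys′ l with splitAt m l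
... | inj₁ _ = ≡.refl
... | inj₂ _ = ≡.refl

module Polynomials {c ℓ} (R : CommutativeRing c ℓ) where

  open Over R public
  open CommutativeRing R public
    renaming (Carrier to K; _*_ to _·_; _+_ to _⊕_; -_ to ⊖_; _-_ to _⊝_)
    hiding (zero)
  open import Algebra.Properties.Ring ring public
    using (-0#≈0#; -‿distribʳ-*; -1*x≈-x; -‿involutive; -‿+-comm; x[y-z]≈xy-xz; [y-z]x≈yx-zx;
           x∙y⁻¹≈ε⇒x≈y; x≈y⇒x∙y⁻¹≈ε; ⁻¹-anti-homo‿-)
  open import Algebra.Properties.CommutativeSemigroup +-commutativeSemigroup public
    using (interchange)
  open import Algebra.Properties.CommutativeSemigroup *-commutativeSemigroup public
    using (x∙yz≈y∙xz)
  open import Relation.Binary.Reasoning.Setoid setoid public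

  xdeg-swapE : ∀ e → xdeg (swapE e) ≡ xdeg e
  xdeg-swapE e = ℕ.+-comm (a₂ e) (a₁ e)

  ydeg-swapE : ∀ e → ydeg (swapE e) ≡ ydeg e
  ydeg-swapE e = ℕ.+-comm (b₂ e) (b₁ e)

  tdeg-swapE : ∀ e → tdeg (swapE e) ≡ tdeg e
  tdeg-swapE e = ≡.cong₂ _+_ (xdeg-swapE e) (ydeg-swapE e)

  0⊝0≈0 : 0# ⊝ 0# ≈ 0#
  0⊝0≈0 = -‿inverseʳ 0#

  x⊝0≈x : ∀ x → x ⊝ 0# ≈ x
  x⊝0≈x x = trans (+-congˡ -0#≈0#) (+-identityʳ x)

  ⊝-telescope : ∀ x y z → (x ⊝ y) ⊕ (y ⊝ z) ≈ x ⊝ z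
  ⊝-telescope x y z = begin
    (x ⊝ y) ⊕ (y ⊝ z)    ≈⟨ +-assoc x (⊖ y) (y ⊝ z) ⟩
    x ⊕ (⊖ y ⊕ (y ⊝ z))  ≈⟨ +-congˡ (+-assoc (⊖ y) y (⊖ z)) ⟨
    x ⊕ ((⊖ y ⊕ y) ⊝ z)  ≈⟨ +-congˡ (+-congʳ (-‿inverseˡ y)) ⟩
    x ⊕ (0# ⊝ z)         ≈⟨ +-congˡ (+-identityˡ (⊖ z)) ⟩
    x ⊝ z                ∎

  ⊝-distrib-⊕ : ∀ x y u v → (x ⊕ y) ⊝ (u ⊕ v) ≈ (x ⊝ u) ⊕ (y ⊝ v)
  ⊝-distrib-⊕ x y u v = trans (+-congˡ (sym (-‿+-comm u v))) (interchange x y (⊖ u) (⊖ v))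

  sumTo-cong : ∀ n {f g : ℕ → K} → (∀ i → i ≤ n → f i ≈ g i) → sumTo n f ≈ sumTo n g
  sumTo-cong zero    f≈g = f≈g 0 z≤n
  sumTo-cong (suc n) f≈g = +-cong (sumTo-cong n λ i i≤n → f≈g i (ℕ.m≤n⇒m≤1+n i≤n)) (f≈g (suc n) ℕ.≤-refl)

  sumTo-zero : ∀ n {f : ℕ → K} → (∀ i → i ≤ n → f i ≈ 0#) → sumTo n f ≈ 0#
  sumTo-zero zero    f≈0 = f≈0 0 z≤n
  sumTo-zero (suc n) f≈0 =
    trans (+-cong (sumTo-zero n λ i i≤n → f≈0 i (ℕ.m≤n⇒m≤1+n i≤n)) (f≈0 (suc n) ℕ.≤-refl)) (+-identityʳ 0#)

  sumTo-⊕ : ∀ n (f g : ℕ → K) → sumTo n (λ i → f i ⊕ g i) ≈ sumTo n f ⊕ sumTo n g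
  sumTo-⊕ zero    f g = refl
  sumTo-⊕ (suc n) f g = trans (+-congʳ (sumTo-⊕ n f g)) (interchange _ _ _ _)

  sumTo-·ˡ : ∀ n x (f : ℕ → K) → sumTo n (λ i → x · f i) ≈ x · sumTo n f
  sumTo-·ˡ zero    x f = refl
  sumTo-·ˡ (suc n) x f = trans (+-congʳ (sumTo-·ˡ n x f)) (sym (distribˡ x _ _))

  sumTo-single : ∀ n {m} (f : ℕ → K) → m ≤ n → (∀ i → i ≤ n → i ≢ m → f i ≈ 0#) → sumTo n f ≈ f m
  sumTo-single zero    f z≤n _ = refl
  sumTo-single (suc n) {m} f m≤1+n f≈0 with m ≟ suc n
  ... | yes ≡.refl =
    trans (+-congʳ (sumTo-zero n λ i i≤n → f≈0 i (ℕ.m≤n⇒m≤1+n i≤n) (ℕ.<⇒≢ (s≤s i≤n)))) (+-identityˡ (f m))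
  ... | no  m≢1+n  =
    trans (+-cong (sumTo-single n f (ℕ.≤-pred (ℕ.≤∧≢⇒< m≤1+n m≢1+n)) λ i i≤n → f≈0 i (ℕ.m≤n⇒m≤1+n i≤n))
                  (f≈0 (suc n) ℕ.≤-refl (m≢1+n ∘ ≡.sym)))
          (+-identityʳ (f m))

  sumFin-cong : ∀ n {f g : Fin n → K} → (∀ l → f l ≈ g l) → sumFin n f ≈ sumFin n g
  sumFin-cong zero    f≈g = refl
  sumFin-cong (suc n) f≈g = +-cong (f≈g Fin.zero) (sumFin-cong n (f≈g ∘ Fin.suc))

  sumFin-zero : ∀ n {f : Fin n → K} → (∀ l → f l ≈ 0#) → sumFin n f ≈ 0#
  sumFin-zero zero    f≈0 = refl
  sumFin-zero (suc n) f≈0 = trans (+-cong (f≈0 Fin.zero) (sumFin-zero n (f≈0 ∘ Fin.suc))) (+-identityʳ 0#)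

  sumFin-·ˡ : ∀ n x (f : Fin n → K) → sumFin n (λ l → x · f l) ≈ x · sumFin n f
  sumFin-·ˡ zero    x f = sym (zeroʳ x)
  sumFin-·ˡ (suc n) x f = trans (+-congˡ (sumFin-·ˡ n x (f ∘ Fin.suc))) (sym (distribˡ x _ _))

  sumFin-single : ∀ n (f : Fin n → K) l → (∀ l′ → l′ ≢ l → f l′ ≈ 0#) → sumFin n f ≈ f l
  sumFin-single (suc n) f Fin.zero f≈0 =
    trans (+-congˡ (sumFin-zero n λ l′ → f≈0 (Fin.suc l′) λ ())) (+-identityʳ (f Fin.zero))
  sumFin-single (suc n) f (Fin.suc l) f≈0 =
    trans (+-congʳ (f≈0 Fin.zero λ ()))
          (trans (+-identityˡ _)
                 (sumFin-single n (f ∘ Fin.suc) l λ l′ l′≢l → f≈0 (Fin.suc l′) (l′≢l ∘ Finₚ.suc-injective)))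

  sumFin-++ : ∀ m {n} (f : Fin m → K) (g : Fin n → K) → sumFin (m + n) (f ++ g) ≈ sumFin m f ⊕ sumFin n g
  sumFin-++ zero    f g = sym (+-identityˡ _)
  sumFin-++ (suc m) f g = begin
    f Fin.zero ⊕ sumFin (m + _) (tail (f ++ g))       ≈⟨ +-congˡ (sumFin-cong (m + _) (reflexive ∘ tail-++ f g)) ⟩
    f Fin.zero ⊕ sumFin (m + _) (tail f ++ g)         ≈⟨ +-congˡ (sumFin-++ m (tail f) g) ⟩
    f Fin.zero ⊕ (sumFin m (tail f) ⊕ sumFin _ g)      ≈⟨ +-assoc _ _ _ ⟨
    (f Fin.zero ⊕ sumFin m (tail f)) ⊕ sumFin _ g      ∎

  sumBelow : Exp → (Exp → K) → K
  sumBelow t F =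
    sumTo (a₁ t) λ x₁ → sumTo (a₂ t) λ x₂ → sumTo (b₁ t) λ y₁ → sumTo (b₂ t) λ y₂ → F (exp x₁ x₂ y₁ y₂)

  sumBelow-cong : ∀ t {F G : Exp → K} → (∀ s → s ≤ₑ t → F s ≈ G s) → sumBelow t F ≈ sumBelow t G
  sumBelow-cong t F≈G =
    sumTo-cong _ λ _ p → sumTo-cong _ λ _ q → sumTo-cong _ λ _ r → sumTo-cong _ λ _ u → F≈G _ (p , q , r , u)

  sumBelow-zero : ∀ t {F : Exp → K} → (∀ s → s ≤ₑ t → F s ≈ 0#) → sumBelow t F ≈ 0#
  sumBelow-zero t F≈0 =
    sumTo-zero _ λ _ p → sumTo-zero _ λ _ q → sumTo-zero _ λ _ r → sumTo-zero _ λ _ u → F≈0 _ (p , q , r , u)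

  sumBelow-⊕ : ∀ t (F G : Exp → K) → sumBelow t (λ s → F s ⊕ G s) ≈ sumBelow t F ⊕ sumBelow t G
  sumBelow-⊕ t F G =
    trans (sumTo-cong (a₁ t) λ _ _ → trans (sumTo-cong (a₂ t) λ _ _ → trans (sumTo-cong (b₁ t) λ _ _ →
      sumTo-⊕ (b₂ t) _ _) (sumTo-⊕ (b₁ t) _ _)) (sumTo-⊕ (a₂ t) _ _)) (sumTo-⊕ (a₁ t) _ _)

  sumBelow-·ˡ : ∀ t x (F : Exp → K) → sumBelow t (λ s → x · F s) ≈ x · sumBelow t F
  sumBelow-·ˡ t x F =
    trans (sumTo-cong (a₁ t) λ _ _ → trans (sumTo-cong (a₂ t) λ _ _ → trans (sumTo-cong (b₁ t) λ _ _ →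
      sumTo-·ˡ (b₂ t) x _) (sumTo-·ˡ (b₁ t) x _)) (sumTo-·ˡ (a₂ t) x _)) (sumTo-·ˡ (a₁ t) x _)

  sumBelow-⊝ : ∀ t (F G : Exp → K) → sumBelow t (λ s → F s ⊝ G s) ≈ sumBelow t F ⊝ sumBelow t G
  sumBelow-⊝ t F G = trans (sumBelow-⊕ t F (⊖_ ∘ G)) (+-congˡ sumBelow-⊖)
    where
    sumBelow-⊖ : sumBelow t (⊖_ ∘ G) ≈ ⊖ sumBelow t G
    sumBelow-⊖ = trans (sumBelow-cong t λ s _ → sym (-1*x≈-x (G s))) (trans (sumBelow-·ˡ t (⊖ 1#) G) (-1*x≈-x _))

  sumBelow-single : ∀ t {u} (F : Exp → K) → u ≤ₑ t → (∀ s → s ≤ₑ t → s ≢ u → F s ≈ 0#) → sumBelow t F ≈ F u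
  sumBelow-single t F (p₁ , p₂ , p₃ , p₄) F≈0 =
    trans (sumTo-single _ _ p₁ λ _ q ne → sumTo-zero _ λ _ r → sumTo-zero _ λ _ s → sumTo-zero _ λ _ v →
             F≈0 _ (q , r , s , v) (ne ∘ ≡.cong a₁)) (
    trans (sumTo-single _ _ p₂ λ _ q ne → sumTo-zero _ λ _ r → sumTo-zero _ λ _ s →
             F≈0 _ (p₁ , q , r , s) (ne ∘ ≡.cong a₂)) (
    trans (sumTo-single _ _ p₃ λ _ q ne → sumTo-zero _ λ _ r →
             F≈0 _ (p₁ , p₂ , q , r) (ne ∘ ≡.cong b₁))
          (sumTo-single _ _ p₄ λ _ q ne → F≈0 _ (p₁ , p₂ , p₃ , q) (ne ∘ ≡.cong b₂))))

  indicator : Bool → K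
  indicator b = if b then 1# else 0#

  -- Opaque, so that δ s e is not unfolded to a comparison of exponents during unification.
  opaque
    δ : Exp → Fun
    δ s e = indicator (does (s ≟ₑ e))

    δ-on : ∀ {s e} → s ≡ e → δ s e ≈ 1#
    δ-on {s} {e} s≡e = reflexive (≡.cong indicator (dec-true (s ≟ₑ e) s≡e))

    δ-off : ∀ {s e} → s ≢ e → δ s e ≈ 0#
    δ-off {s} {e} s≢e = reflexive (≡.cong indicator (dec-false (s ≟ₑ e) s≢e))

  δ-diag : ∀ s → δ s s ≈ 1#
  δ-diag s = δ-on ≡.refl

  δ-resp-⇔ : ∀ {s e s′ e′} → (s ≡ e → s′ ≡ e′) → (s′ ≡ e′ → s ≡ e) → δ s e ≈ δ s′ e′
  δ-resp-⇔ {s} {e} to from with s ≟ₑ e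
  ... | yes s≡e = trans (δ-on s≡e) (sym (δ-on (to s≡e)))
  ... | no  s≢e = trans (δ-off s≢e) (sym (δ-off (s≢e ∘ from)))

  Finite-δ : ∀ s → Finite (δ s)
  Finite-δ s = tdeg s , λ e s<e → δ-off λ s≡e → ℕ.<-irrefl (≡.cong tdeg s≡e) s<e

  δ-shift : ∀ {s e} t → s ≤ₑ e → δ t (e ∸ₑ s) ≈ δ (s +ₑ t) e
  δ-shift {s} {e} t s≤e = δ-resp-⇔ (λ t≡e∸s → ≡.trans (≡.cong (s +ₑ_) t≡e∸s) (+ₑ-∸ₑ s≤e))
                                   (λ s+t≡e → ≡.trans (≡.sym (+ₑ-∸ₑ-cancel s t)) (≡.cong (_∸ₑ s) s+t≡e))

  δ-+ₑ-≰ₑ : ∀ {s e} t → ¬ s ≤ₑ e → δ (s +ₑ t) e ≈ 0#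
  δ-+ₑ-≰ₑ {s} t s≰e = δ-off λ s+t≡e → s≰e (≡.subst (s ≤ₑ_) s+t≡e (≤ₑ-+ₑ s t))

  δ⋆-≤ₑ : ∀ s h {e} → s ≤ₑ e → (δ s ⋆ h) e ≈ h (e ∸ₑ s)
  δ⋆-≤ₑ s h s≤e =
    trans (sumBelow-single _ (λ x → δ s x · h (_ ∸ₑ x)) s≤e λ x _ x≢s → trans (*-congʳ (δ-off (x≢s ∘ ≡.sym))) (zeroˡ _))
          (trans (*-congʳ (δ-diag s)) (*-identityˡ _))

  δ⋆-≰ₑ : ∀ s h {e} → ¬ s ≤ₑ e → (δ s ⋆ h) e ≈ 0#
  δ⋆-≰ₑ s h {e} s≰e = sumBelow-zero e λ x x≤e →
    trans (*-congʳ (δ-off λ s≡x → s≰e (≡.subst (_≤ₑ e) (≡.sym s≡x) x≤e))) (zeroˡ _)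

  ⋆-congˡ : ∀ {p q} d e → (∀ e′ → p e′ ≈ q e′) → (p ⋆ d) e ≈ (q ⋆ d) e
  ⋆-congˡ d e p≈q = sumBelow-cong e λ x _ → *-congʳ (p≈q x)

  ⋆-distribʳ : ∀ p q d e → ((λ e′ → p e′ ⊕ q e′) ⋆ d) e ≈ (p ⋆ d) e ⊕ (q ⋆ d) e
  ⋆-distribʳ p q d e = trans (sumBelow-cong e λ x _ → distribʳ _ (p x) (q x)) (sumBelow-⊕ e _ _)

  ⋆-·ˡ : ∀ x p d e → ((λ e′ → x · p e′) ⋆ d) e ≈ x · (p ⋆ d) e
  ⋆-·ˡ x p d e = trans (sumBelow-cong e λ y _ → *-assoc x (p y) _) (sumBelow-·ˡ e x _)

  ⋆-sumToˡ : ∀ n (G : ℕ → Fun) d e → ((λ e′ → sumTo n λ i → G i e′) ⋆ d) e ≈ sumTo n (λ i → (G i ⋆ d) e)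
  ⋆-sumToˡ zero    G d e = refl
  ⋆-sumToˡ (suc n) G d e = trans (⋆-distribʳ _ (G (suc n)) d e) (+-congʳ (⋆-sumToˡ n G d e))

  ⋆-sumBelowˡ : ∀ t (G : Exp → Fun) d e → ((λ e′ → sumBelow t λ s → G s e′) ⋆ d) e ≈ sumBelow t (λ s → (G s ⋆ d) e)
  ⋆-sumBelowˡ t G d e =
    trans (⋆-sumToˡ (a₁ t) _ d e) (sumTo-cong (a₁ t) λ _ _ →
    trans (⋆-sumToˡ (a₂ t) _ d e) (sumTo-cong (a₂ t) λ _ _ →
    trans (⋆-sumToˡ (b₁ t) _ d e) (sumTo-cong (b₁ t) λ _ _ →
    ⋆-sumToˡ (b₂ t) _ d e)))

  box : ℕ → Exp
  box N = exp N N N N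

  ≤ₑ-box : ∀ {N} e → tdeg e ≤ N → e ≤ₑ box N
  ≤ₑ-box e deg≤N =
    ℕ.≤-trans (ℕ.≤-trans (ℕ.m≤m+n (a₁ e) (a₂ e)) (ℕ.m≤m+n (xdeg e) (ydeg e))) deg≤N ,
    ℕ.≤-trans (ℕ.≤-trans (ℕ.m≤n+m (a₂ e) (a₁ e)) (ℕ.m≤m+n (xdeg e) (ydeg e))) deg≤N ,
    ℕ.≤-trans (ℕ.≤-trans (ℕ.m≤m+n (b₁ e) (b₂ e)) (ℕ.m≤n+m (ydeg e) (xdeg e))) deg≤N ,
    ℕ.≤-trans (ℕ.≤-trans (ℕ.m≤n+m (b₂ e) (b₁ e)) (ℕ.m≤n+m (ydeg e) (xdeg e))) deg≤N

  VanishesAbove : ℕ → Fun → Set ℓ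
  VanishesAbove N p = ∀ e → N < tdeg e → p e ≈ 0#

  monomial-expansion : ∀ {N f} → VanishesAbove N f → ∀ e → sumBelow (box N) (λ s → f s · δ s e) ≈ f e
  monomial-expansion {N} {f} f-bounded e with e ≤ₑ? box N
  ... | yes e≤box = trans (sumBelow-single (box N) (λ s → f s · δ s e) e≤box λ s _ s≢e →
                             trans (*-congˡ (δ-off s≢e)) (zeroʳ _))
                          (trans (*-congˡ (δ-diag e)) (*-identityʳ _))
  ... | no  e≰box = trans (sumBelow-zero (box N) λ s s≤box →
                             trans (*-congˡ (δ-off λ s≡e → e≰box (≡.subst (_≤ₑ box N) s≡e s≤box))) (zeroʳ _))
                          (sym (f-bounded e (ℕ.≰⇒> (e≰box ∘ ≤ₑ-box e))))

  ⋆-expandˡ : ∀ {N f} → VanishesAbove N f → ∀ d e → (f ⋆ d) e ≈ sumBelow (box N) (λ s → f s · (δ s ⋆ d) e)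
  ⋆-expandˡ {N} {f} f-bounded d e = begin
    (f ⋆ d) e                                              ≈⟨ ⋆-congˡ d e (sym ∘ monomial-expansion f-bounded) ⟩
    ((λ e′ → sumBelow (box N) λ s → f s · δ s e′) ⋆ d) e   ≈⟨ ⋆-sumBelowˡ (box N) _ d e ⟩
    sumBelow (box N) (λ s → ((λ e′ → f s · δ s e′) ⋆ d) e) ≈⟨ sumBelow-cong (box N) (λ s _ → ⋆-·ˡ (f s) (δ s) d e) ⟩
    sumBelow (box N) (λ s → f s · (δ s ⋆ d) e)             ∎

  Alt : Exp → Fun
  Alt t e = δ t e ⊝ δ (swapE t) e

  Alt-swapE : ∀ t e → Alt (swapE t) e ≈ ⊖ Alt t e
  Alt-swapE t e = sym (⁻¹-anti-homo‿- (δ t e) (δ (swapE t) e))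

  δ-swapE : ∀ s e → δ s (swapE e) ≈ δ (swapE s) e
  δ-swapE s e = δ-resp-⇔ (≡.cong swapE) (≡.cong swapE)

  Finite-Alt : ∀ t → Finite (Alt t)
  Finite-Alt t = tdeg t , λ e t<e →
    trans (+-cong (proj₂ (Finite-δ t) e t<e)
                  (-‿cong (proj₂ (Finite-δ (swapE t)) e (≡.subst (_< tdeg e) (≡.sym (tdeg-swapE t)) t<e))))
          0⊝0≈0

  Alt-at-swapE : ∀ t e → Alt t (swapE e) ≈ ⊖ Alt t e
  Alt-at-swapE t e = trans (+-cong (δ-swapE t e) (-‿cong (δ-swapE (swapE t) e))) (Alt-swapE t e)

  δ⋆Alt : ∀ s t e → (δ s ⋆ Alt t) e ≈ δ (s +ₑ t) e ⊝ δ (s +ₑ swapE t) e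
  δ⋆Alt s t e with s ≤ₑ? e
  ... | yes s≤e = trans (δ⋆-≤ₑ s (Alt t) s≤e) (+-cong (δ-shift t s≤e) (-‿cong (δ-shift (swapE t) s≤e)))
  ... | no  s≰e = trans (δ⋆-≰ₑ s (Alt t) s≰e)
                        (sym (trans (+-cong (δ-+ₑ-≰ₑ t s≰e) (-‿cong (δ-+ₑ-≰ₑ (swapE t) s≰e))) 0⊝0≈0))

  Alt-+ₑ : ∀ s t e → Alt (s +ₑ t) e ≈ (δ s ⋆ Alt t) e ⊕ (δ (swapE t) ⋆ Alt s) e
  Alt-+ₑ s t e = begin
    δ (s +ₑ t) e ⊝ δ (swapE s +ₑ swapE t) e
      ≈⟨ ⊝-telescope _ (δ (s +ₑ swapE t) e) _ ⟨
    (δ (s +ₑ t) e ⊝ δ (s +ₑ swapE t) e) ⊕ (δ (s +ₑ swapE t) e ⊝ δ (swapE s +ₑ swapE t) e)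
      ≈⟨ +-congˡ (+-cong (reflexive (≡.cong (λ u → δ u e) (+ₑ-comm s (swapE t))))
                         (-‿cong (reflexive (≡.cong (λ u → δ u e) (+ₑ-comm (swapE s) (swapE t)))))) ⟩
    (δ (s +ₑ t) e ⊝ δ (s +ₑ swapE t) e) ⊕ (δ (swapE t +ₑ s) e ⊝ δ (swapE t +ₑ swapE s) e)
      ≈⟨ +-cong (δ⋆Alt s t e) (δ⋆Alt (swapE t) s e) ⟨
    (δ s ⋆ Alt t) e ⊕ (δ (swapE t) ⋆ Alt s) e ∎

  record IsSubspace {u} (P : Fun → Set u) : Set (c ⊔ ℓ ⊔ u) where
    field
      ≈-closed : ∀ {p q} → (∀ e → p e ≈ q e) → P p → P q
      0-closed : P (λ _ → 0#)
      ⊕-closed : ∀ {p q} → P p → P q → P (λ e → p e ⊕ q e)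
      ·-closed : ∀ x {p} → P p → P (λ e → x · p e)

    sumTo-closed : ∀ n (G : ℕ → Fun) → (∀ i → P (G i)) → P (λ e → sumTo n λ i → G i e)
    sumTo-closed zero    G G∈P = G∈P 0
    sumTo-closed (suc n) G G∈P = ⊕-closed (sumTo-closed n G G∈P) (G∈P (suc n))

    sumFin-closed : ∀ n (G : Fin n → Fun) → (∀ l → P (G l)) → P (λ e → sumFin n λ l → G l e)
    sumFin-closed zero    G G∈P = 0-closed
    sumFin-closed (suc n) G G∈P = ⊕-closed (G∈P Fin.zero) (sumFin-closed n (G ∘ Fin.suc) (G∈P ∘ Fin.suc))

    sumBelow-closed : ∀ t (G : Exp → Fun) → (∀ s → P (G s)) → P (λ e → sumBelow t λ s → G s e)
    sumBelow-closed t G G∈P =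
      sumTo-closed (a₁ t) _ λ _ → sumTo-closed (a₂ t) _ λ _ → sumTo-closed (b₁ t) _ λ _ →
      sumTo-closed (b₂ t) _ λ _ → G∈P _

  open IsSubspace public

  Bihom-subspace : ∀ i j → IsSubspace (Bihom i j)
  Bihom-subspace i j = record
    { ≈-closed = λ p≈q p-bihom e wrong → trans (sym (p≈q e)) (p-bihom e wrong)
    ; 0-closed = λ _ _ → refl
    ; ⊕-closed = λ p-bihom q-bihom e wrong → trans (+-cong (p-bihom e wrong) (q-bihom e wrong)) (+-identityʳ 0#)
    ; ·-closed = λ x p-bihom e wrong → trans (*-congˡ (p-bihom e wrong)) (zeroʳ x)
    }

  Finite-· : ∀ x {p} → Finite p → Finite (λ e → x · p e)
  Finite-· x (N , p-bounded) = N , λ e N<deg → trans (*-congˡ (p-bounded e N<deg)) (zeroʳ x)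

  Bihom-Alt : ∀ {i j t} → xdeg t ≡ i × ydeg t ≡ j → Bihom i j (Alt t)
  Bihom-Alt {i} {j} {t} (xt , yt) e wrong =
    trans (+-cong (δ-off (wrong ∘ bidegree-of t (xt , yt)))
                  (-‿cong (δ-off (wrong ∘ bidegree-of (swapE t)
                                                      (≡.trans (xdeg-swapE t) xt , ≡.trans (ydeg-swapE t) yt)))))
          0⊝0≈0
    where
    bidegree-of : ∀ u → xdeg u ≡ i × ydeg u ≡ j → u ≡ e → xdeg e ≡ i × ydeg e ≡ j
    bidegree-of u bideg ≡.refl = bideg

  lincomb-⊕ : ∀ r cs cs′ us e → lincomb r (λ l → cs l ⊕ cs′ l) us e ≈ lincomb r cs us e ⊕ lincomb r cs′ us e
  lincomb-⊕ zero    cs cs′ us e = sym (+-identityʳ 0#)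
  lincomb-⊕ (suc r) cs cs′ us e =
    trans (+-cong (distribʳ _ _ _) (lincomb-⊕ r (cs ∘ Fin.suc) (cs′ ∘ Fin.suc) (us ∘ Fin.suc) e)) (interchange _ _ _ _)

  lincomb-· : ∀ r x cs us e → lincomb r (λ l → x · cs l) us e ≈ x · lincomb r cs us e
  lincomb-· r x cs us e = trans (sumFin-cong r λ l → *-assoc x (cs l) _) (sumFin-·ˡ r x _)

  lincomb-zero : ∀ r us e → lincomb r (λ _ → 0#) us e ≈ 0#
  lincomb-zero r us e = sumFin-zero r λ l → zeroˡ _

  lincomb-unit : ∀ r us l e → lincomb r (λ l′ → indicator (does (l′ Finₚ.≟ l))) us e ≈ us l e
  lincomb-unit r us l e =
    trans (sumFin-single r _ l λ l′ l′≢l →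
             trans (*-congʳ (reflexive (≡.cong indicator (dec-false (l′ Finₚ.≟ l) l′≢l)))) (zeroˡ _))
          (trans (*-congʳ (reflexive (≡.cong indicator (dec-true (l Finₚ.≟ l) ≡.refl)))) (*-identityˡ _))

  restrict : (ℕ → ℕ → Bool) → Fun → Fun
  restrict b p e = indicator (b (xdeg e) (ydeg e)) · p e

  restrict-on : ∀ b p {e} → b (xdeg e) (ydeg e) ≡ true → restrict b p e ≈ p e
  restrict-on b p on = trans (*-congʳ (reflexive (≡.cong indicator on))) (*-identityˡ _)

  restrict-off : ∀ b p {e} → b (xdeg e) (ydeg e) ≡ false → restrict b p e ≈ 0#
  restrict-off b p off = trans (*-congʳ (reflexive (≡.cong indicator off))) (zeroˡ _)

  shift : Exp → (ℕ → ℕ → Bool) → ℕ → ℕ → Bool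
  shift s b x y = b (xdeg s + x) (ydeg s + y)

  restrict-δ⋆ : ∀ b s d e → restrict b (δ s ⋆ d) e ≈ (δ s ⋆ restrict (shift s b) d) e
  restrict-δ⋆ b s d e with s ≤ₑ? e
  ... | yes s≤e = begin
    indicator (b (xdeg e) (ydeg e)) · (δ s ⋆ d) e
      ≈⟨ *-congˡ (δ⋆-≤ₑ s d s≤e) ⟩
    indicator (b (xdeg e) (ydeg e)) · d (e ∸ₑ s)
      ≡⟨ ≡.cong (λ u → indicator (b (xdeg u) (ydeg u)) · d (e ∸ₑ s)) (≡.sym (+ₑ-∸ₑ s≤e)) ⟩
    indicator (b (xdeg (s +ₑ (e ∸ₑ s))) (ydeg (s +ₑ (e ∸ₑ s)))) · d (e ∸ₑ s)
      ≡⟨ ≡.cong₂ (λ x y → indicator (b x y) · d (e ∸ₑ s)) (xdeg-+ₑ s (e ∸ₑ s)) (ydeg-+ₑ s (e ∸ₑ s)) ⟩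
    restrict (shift s b) d (e ∸ₑ s)
      ≈⟨ δ⋆-≤ₑ s (restrict (shift s b) d) s≤e ⟨
    (δ s ⋆ restrict (shift s b) d) e ∎
  ... | no  s≰e = trans (*-congˡ (δ⋆-≰ₑ s d s≰e)) (trans (zeroʳ _) (sym (δ⋆-≰ₑ s (restrict (shift s b) d) s≰e)))

  isBidegree : ℕ → ℕ → ℕ → ℕ → Bool
  isBidegree i j x y = does (x ≟ i ×-dec y ≟ j)

  Bihom-restrict : ∀ i j p → Bihom i j (restrict (isBidegree i j) p)
  Bihom-restrict i j p e wrong = restrict-off (isBidegree i j) p (dec-false (xdeg e ≟ i ×-dec ydeg e ≟ j) wrong)

  restrict-Bihom : ∀ {i j p} → Bihom i j p → ∀ e → restrict (isBidegree i j) p e ≈ p e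
  restrict-Bihom {i} {j} {p} p-bihom e with xdeg e ≟ i ×-dec ydeg e ≟ j
  ... | yes right = restrict-on (isBidegree i j) p (dec-true (xdeg e ≟ i ×-dec ydeg e ≟ j) right)
  ... | no  wrong = trans (restrict-off (isBidegree i j) p (dec-false (xdeg e ≟ i ×-dec ydeg e ≟ j) wrong))
                          (sym (p-bihom e wrong))

module Dihedral {c ℓ} (R : CommutativeRing c ℓ) (isField : Over.IsField R) (char0 : Over.CharZero R)
                (k′ : ℕ) (ζ : CommutativeRing.Carrier R) (ζ-primitive : Over.PrimitiveRoot R (2 + k′) ζ) where

  open Polynomials R

  k : ℕ
  k = 2 + k′

  pow-+ : ∀ x m n → pow x (m + n) ≈ pow x m · pow x n
  pow-+ x zero    n = sym (*-identityˡ _)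
  pow-+ x (suc m) n = trans (*-congˡ (pow-+ x m n)) (sym (*-assoc _ _ _))

  pow-*k : ∀ q → pow ζ (q * k) ≈ 1#
  pow-*k zero    = refl
  pow-*k (suc q) = trans (pow-+ ζ k (q * k)) (trans (*-cong (proj₁ ζ-primitive) (pow-*k q)) (*-identityˡ 1#))

  pow-∣ : ∀ {m} → k ∣ m → pow ζ m ≈ 1#
  pow-∣ (divides q ≡.refl) = pow-*k q

  pow-∤ : ∀ {m} → ¬ k ∣ m → ¬ pow ζ m ≈ 1#
  pow-∤ {m} k∤m ζᵐ≈1 with m % k in m%k≡
  ... | zero  = k∤m (m%n≡0⇒n∣m m k m%k≡)
  ... | suc r = proj₂ ζ-primitive (suc r) (s≤s z≤n) (≡.subst (_< k) m%k≡ (m%n<n m k)) (begin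
    pow ζ (suc r)                     ≈⟨ *-identityʳ _ ⟨
    pow ζ (suc r) · 1#                ≈⟨ *-congˡ (pow-*k (m / k)) ⟨
    pow ζ (suc r) · pow ζ (m / k * k) ≈⟨ pow-+ ζ (suc r) _ ⟨
    pow ζ (suc r + m / k * k)         ≡⟨ ≡.cong (λ n → pow ζ (n + m / k * k)) m%k≡ ⟨
    pow ζ (m % k + m / k * k)         ≡⟨ ≡.cong (pow ζ) (m≡m%n+[m/n]*n m k) ⟨
    pow ζ m                           ≈⟨ ζᵐ≈1 ⟩
    1#                                ∎)

  ≉0-cancel : ∀ {x y} → ¬ x ≈ 0# → x · y ≈ 0# → y ≈ 0#
  ≉0-cancel {x} {y} x≉0 xy≈0 with proj₂ isField x x≉0
  ... | x⁻¹ , xx⁻¹≈1 = begin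
    y               ≈⟨ *-identityˡ y ⟨
    1# · y          ≈⟨ *-congʳ (trans (sym xx⁻¹≈1) (*-comm x x⁻¹)) ⟩
    (x⁻¹ · x) · y   ≈⟨ *-assoc x⁻¹ x y ⟩
    x⁻¹ · (x · y)   ≈⟨ *-congˡ xy≈0 ⟩
    x⁻¹ · 0#        ≈⟨ zeroʳ x⁻¹ ⟩
    0#              ∎

  2≉0 : ¬ 1# ⊕ 1# ≈ 0#
  2≉0 2≈0 with char0 2 (trans (+-congˡ (+-identityʳ 1#)) 2≈0)
  ... | ()

  x⊕x≈0⇒x≈0 : ∀ x → x ⊕ x ≈ 0# → x ≈ 0#
  x⊕x≈0⇒x≈0 x x⊕x≈0 = ≉0-cancel 2≉0 (trans (distribʳ x 1# 1#) (trans (+-cong (*-identityˡ x) (*-identityˡ x)) x⊕x≈0))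

  ½ : K
  ½ = proj₁ (proj₂ isField (1# ⊕ 1#) 2≉0)

  ½·[x⊕x]≈x : ∀ x → ½ · (x ⊕ x) ≈ x
  ½·[x⊕x]≈x x = begin
    ½ · (x ⊕ x)               ≈⟨ *-congˡ (+-cong (*-identityˡ x) (*-identityˡ x)) ⟨
    ½ · (1# · x ⊕ 1# · x)     ≈⟨ *-congˡ (distribʳ x 1# 1#) ⟨
    ½ · ((1# ⊕ 1#) · x)       ≈⟨ *-assoc ½ _ x ⟨
    (½ · (1# ⊕ 1#)) · x       ≈⟨ *-congʳ (trans (*-comm ½ _) (proj₂ (proj₂ isField (1# ⊕ 1#) 2≉0))) ⟩
    1# · x                    ≈⟨ *-identityˡ x ⟩
    x                         ∎

  wt : Exp → ℕ
  wt e = (a₁ e + b₁ e) + suc k′ * (a₂ e + b₂ e)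

  rotAct-wt : ∀ l p e → rotAct k ζ l p e ≈ pow ζ (l * wt e) · p e
  rotAct-wt l p e = reflexive (≡.cong (λ n → pow ζ n · p e) (exponent k′ l (a₁ e + b₁ e) (a₂ e + b₂ e)))
    where
    exponent : ∀ k′ l m n → l * m + l * suc k′ * n ≡ l * (m + suc k′ * n)
    exponent = solve-∀

  wt-+ₑ : ∀ s t → wt (s +ₑ t) ≡ wt s + wt t
  wt-+ₑ s t = lemma k′ (a₁ s) (a₂ s) (b₁ s) (b₂ s) (a₁ t) (a₂ t) (b₁ t) (b₂ t)
    where
    lemma : ∀ k′ a b c d a′ b′ c′ d′ → ((a + a′) + (c + c′)) + suc k′ * ((b + b′) + (d + d′))
                                   ≡ ((a + c) + suc k′ * (b + d)) + ((a′ + c′) + suc k′ * (b′ + d′))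
    lemma = solve-∀

  wt-swapE : ∀ t → wt t + wt (swapE t) ≡ tdeg t * k
  wt-swapE t = lemma k′ (a₁ t) (a₂ t) (b₁ t) (b₂ t)
    where
    lemma : ∀ k′ a b c d → ((a + c) + suc k′ * (b + d)) + ((b + d) + suc k′ * (a + c)) ≡ ((a + b) + (c + d)) * (2 + k′)
    lemma = solve-∀

  ∣wt-swapE : ∀ t → k ∣ wt t → k ∣ wt (swapE t)
  ∣wt-swapE t k∣t = ∣m+n∣m⇒∣n (divides (tdeg t) (wt-swapE t)) k∣t

  ∣wt-+ₑ-cancel : ∀ s t → k ∣ wt s → k ∣ wt (s +ₑ t) → k ∣ wt t
  ∣wt-+ₑ-cancel s t k∣s k∣s+t = ∣m+n∣m⇒∣n (≡.subst (k ∣_) (wt-+ₑ s t) k∣s+t) k∣s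

  wt-pure : ∀ a b → wt (exp a 0 b 0) ≡ a + b
  wt-pure a b = ≡.trans (≡.cong ((a + b) +_) (ℕ.*-zeroʳ (suc k′))) (ℕ.+-identityʳ (a + b))

  -- 1 + (k - 1) · 1 is the weight of z₁ z₂, of w₁ w₂ and of z₁ w₂.
  k∣1+[k-1] : k ∣ 1 + suc k′ * 1
  k∣1+[k-1] = ≡.subst (k ∣_) (≡.cong (1 +_) (≡.sym (ℕ.*-identityʳ (suc k′)))) (n∣n {k})

  ∤-small : ∀ {m} → 0 < m → m < k → ¬ k ∣ m
  ∤-small {suc m} _ m<k k∣m = ℕ.<⇒≱ m<k (∣⇒≤ k∣m)

  Det : Fun → Set ℓ
  Det = Determinantal k ζ

  Det-∤wt : ∀ {d} → Det d → ∀ {e} → ¬ k ∣ wt e → d e ≈ 0#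
  Det-∤wt {d} (_ , d-det) {e} k∤wt = ≉0-cancel (pow-∤ k∤wt ∘ x∙y⁻¹≈ε⇒x≈y _ _) (begin
    (pow ζ (wt e) ⊝ 1#) · d e        ≈⟨ [y-z]x≈yx-zx (d e) _ _ ⟩
    pow ζ (wt e) · d e ⊝ 1# · d e    ≈⟨ x≈y⇒x∙y⁻¹≈ε ρ-fixes-d ⟩
    0#                               ∎)
    where
    ρ-fixes-d : pow ζ (wt e) · d e ≈ 1# · d e
    ρ-fixes-d = begin
      pow ζ (wt e) · d e      ≡⟨ ≡.cong (λ n → pow ζ n · d e) (ℕ.*-identityˡ (wt e)) ⟨
      pow ζ (1 * wt e) · d e  ≈⟨ rotAct-wt 1 d e ⟨
      rotAct k ζ 1 d e        ≈⟨ d-det (rot (Fin.suc Fin.zero)) e ⟩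
      1# · d e                ∎

  Det-swapE : ∀ {d} → Det d → ∀ e → d (swapE e) ≈ ⊖ d e
  Det-swapE {d} (_ , d-det) e = trans (sym (*-identityˡ _)) (trans (d-det (rfl Fin.zero) e) (-1*x≈-x (d e)))

  Det-0ₑ : ∀ {d} → Det d → d 0ₑ ≈ 0#
  Det-0ₑ {d} d-det = x⊕x≈0⇒x≈0 (d 0ₑ) (trans (+-congˡ (Det-swapE d-det 0ₑ)) (-‿inverseʳ (d 0ₑ)))

  Det-restrict : ∀ b {d} → Det d → Det (restrict b d)
  Det-restrict b {d} ((N , d-bounded) , d-det) =
    (N , λ e N<e → trans (*-congˡ (d-bounded e N<e)) (zeroʳ _)) , λ where
      (rot l) e → masked (d-det (rot l) e)
      (rfl l) e → trans (*-congˡ (*-congʳ (reflexive (≡.cong indicator (≡.cong₂ b (xdeg-swapE e) (ydeg-swapE e))))))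
                        (masked (d-det (rfl l) e))
    where
    masked : ∀ {x y u v m} → x · u ≈ y · v → x · (m · u) ≈ y · (m · v)
    masked {x} {y} {u} {v} {m} xu≈yv = trans (x∙yz≈y∙xz x m u) (trans (*-congˡ xu≈yv) (sym (x∙yz≈y∙xz y m v)))

  Det-Alt : ∀ {t} → k ∣ wt t → Det (Alt t)
  Det-Alt {t} k∣t = Finite-Alt t , λ where
      (rot l) e → trans (rotAct-wt (toℕ l) (Alt t) e) (trans (ρ-fixes-Alt (toℕ l) e) (sym (*-identityˡ _)))
      (rfl l) e → begin
        rotAct k ζ (toℕ l) (reflAct (Alt t)) e  ≈⟨ rotAct-wt (toℕ l) (reflAct (Alt t)) e ⟩
        pow ζ (toℕ l * wt e) · Alt t (swapE e)  ≈⟨ *-congˡ (Alt-at-swapE t e) ⟩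
        pow ζ (toℕ l * wt e) · ⊖ Alt t e        ≈⟨ -‿distribʳ-* _ _ ⟨
        ⊖ (pow ζ (toℕ l * wt e) · Alt t e)      ≈⟨ -‿cong (ρ-fixes-Alt (toℕ l) e) ⟩
        ⊖ Alt t e                               ≈⟨ -1*x≈-x (Alt t e) ⟨
        ⊖ 1# · Alt t e                          ∎
    where
    ρ-fixes-δ : ∀ {q} → k ∣ wt q → ∀ l e → pow ζ (l * wt e) · δ q e ≈ δ q e
    ρ-fixes-δ {q} k∣q l e with q ≟ₑ e
    ... | yes ≡.refl = trans (*-congʳ (pow-∣ (∣n⇒∣m*n l k∣q))) (*-identityˡ _)
    ... | no  q≢e    = trans (*-congˡ (δ-off q≢e)) (trans (zeroʳ _) (sym (δ-off q≢e)))
    ρ-fixes-Alt : ∀ l e → pow ζ (l * wt e) · Alt t e ≈ Alt t e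
    ρ-fixes-Alt l e =
      trans (x[y-z]≈xy-xz _ _ _) (+-cong (ρ-fixes-δ k∣t l e) (-‿cong (ρ-fixes-δ (∣wt-swapE t k∣t) l e)))

  Det-alternant-expansion : ∀ {N B} → VanishesAbove N B → Det B → ∀ e →
                            sumBelow (box N) (λ s → (½ · B s) · Alt s e) ≈ B e
  Det-alternant-expansion {N} {B} B-bounded B-det e = begin
    sumBelow (box N) (λ s → (½ · B s) · Alt s e)
      ≈⟨ sumBelow-cong (box N) (λ s _ → *-assoc ½ (B s) (Alt s e)) ⟩
    sumBelow (box N) (λ s → ½ · (B s · Alt s e))
      ≈⟨ sumBelow-·ˡ (box N) ½ _ ⟩
    ½ · sumBelow (box N) (λ s → B s · Alt s e)
      ≈⟨ *-congˡ (sumBelow-cong (box N) λ s _ →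
           trans (x[y-z]≈xy-xz (B s) _ _) (+-congˡ (-‿cong (*-congˡ (sym (δ-swapE s e)))))) ⟩
    ½ · sumBelow (box N) (λ s → B s · δ s e ⊝ B s · δ s (swapE e))
      ≈⟨ *-congˡ (sumBelow-⊝ (box N) _ _) ⟩
    ½ · (sumBelow (box N) (λ s → B s · δ s e) ⊝ sumBelow (box N) (λ s → B s · δ s (swapE e)))
      ≈⟨ *-congˡ (+-cong (monomial-expansion B-bounded e) (-‿cong (monomial-expansion B-bounded (swapE e)))) ⟩
    ½ · (B e ⊝ B (swapE e))
      ≈⟨ *-congˡ (+-congˡ (trans (-‿cong (Det-swapE B-det e)) (-‿involutive (B e)))) ⟩
    ½ · (B e ⊕ B e)
      ≈⟨ ½·[x⊕x]≈x (B e) ⟩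
    B e ∎

  InA-Det : ∀ {d} → Det d → InA k ζ d
  InA-Det {d} d-det = 1 , (λ _ → δ 0ₑ) , (λ _ → d) , (λ _ → Finite-δ 0ₑ) , (λ _ → d-det) ,
                      λ e → sym (trans (+-identityʳ _) (δ⋆-≤ₑ 0ₑ d (0ₑ-≤ₑ e)))

  InXY-δ : ∀ {s} → s ≢ 0ₑ → InXY (δ s)
  InXY-δ {s} s≢0 = Finite-δ s , δ-off s≢0

  InXYA-⋆ : ∀ {g a} → InXY g → InA k ζ a → InXYA k ζ (g ⋆ a)
  InXYA-⋆ {g} {a} g∈XY a∈A = 1 , (λ _ → g) , (λ _ → a) , (λ _ → g∈XY) , (λ _ → a∈A) , λ e → sym (+-identityʳ _)

  InXYA-⊕ : ∀ {p q} → InXYA k ζ p → InXYA k ζ q → InXYA k ζ (λ e → p e ⊕ q e)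
  InXYA-⊕ {p} {q} (n , g , a , g∈XY , a∈A , p≈) (m , g′ , a′ , g′∈XY , a′∈A , q≈) =
    n + m , g ++ g′ , a ++ a′ , ++⁺ InXY g∈XY g′∈XY , ++⁺ (InA k ζ) a∈A a′∈A , λ e → begin
      p e ⊕ q e
        ≈⟨ +-cong (p≈ e) (q≈ e) ⟩
      sumFin n (λ l → (g l ⋆ a l) e) ⊕ sumFin m (λ l → (g′ l ⋆ a′ l) e)
        ≈⟨ sumFin-++ n _ _ ⟨
      sumFin (n + m) (zipWith (λ g a → (g ⋆ a) e) g a ++ zipWith (λ g a → (g ⋆ a) e) g′ a′)
        ≈⟨ sumFin-cong (n + m) (reflexive ∘ zipWith-++ (λ g a → (g ⋆ a) e) g g′ a a′) ⟨
      sumFin (n + m) (λ l → ((g ++ g′) l ⋆ (a ++ a′) l) e) ∎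

  InXYA-· : ∀ x {p} → InXYA k ζ p → InXYA k ζ (λ e → x · p e)
  InXYA-· x (n , g , a , g∈XY , a∈A , p≈) =
    n , (λ l e → x · g l e) , a , (λ l → InXY-· (g∈XY l)) , a∈A , λ e →
      trans (*-congˡ (p≈ e)) (trans (sym (sumFin-·ˡ n x _)) (sumFin-cong n λ l → sym (⋆-·ˡ x (g l) (a l) e)))
    where
    InXY-· : ∀ {g} → InXY g → InXY (λ e → x · g e)
    InXY-· (g-finite , g0≈0) = Finite-· x g-finite , trans (*-congˡ g0≈0) (zeroʳ x)

  InXYA-subspace : IsSubspace (InXYA k ζ)
  InXYA-subspace = record
    { ≈-closed = λ { p≈q (n , g , a , g∈XY , a∈A , p≈) → n , g , a , g∈XY , a∈A , λ e → trans (sym (p≈q e)) (p≈ e) }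
    ; 0-closed = 0 , (λ ()) , (λ ()) , (λ ()) , (λ ()) , λ _ → refl
    ; ⊕-closed = InXYA-⊕
    ; ·-closed = InXYA-·
    }

  Alt-+ₑ-∈XYA : ∀ {s t} → s ≢ 0ₑ → t ≢ 0ₑ → k ∣ wt s → k ∣ wt t → InXYA k ζ (Alt (s +ₑ t))
  Alt-+ₑ-∈XYA {s} {t} s≢0 t≢0 k∣s k∣t =
    ≈-closed InXYA-subspace (sym ∘ Alt-+ₑ s t)
      (⊕-closed InXYA-subspace (InXYA-⋆ (InXY-δ s≢0) (InA-Det (Det-Alt k∣t)))
                               (InXYA-⋆ (InXY-δ (t≢0 ∘ ≡.cong swapE)) (InA-Det (Det-Alt k∣s))))

  Negligible : Exp → Set
  Negligible u = u ≡ 0ₑ ⊎ ¬ k ∣ wt u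

  Det-negligible : ∀ {d u} → Det d → Negligible u → d u ≈ 0#
  Det-negligible d-det (inj₁ ≡.refl) = Det-0ₑ d-det
  Det-negligible d-det (inj₂ k∤wt)   = Det-∤wt d-det k∤wt

  InA-negligible : ∀ {a t} → (∀ u → u ≤ₑ t → Negligible u) → InA k ζ a → a t ≈ 0#
  InA-negligible {t = t} negligible (n , f , d , _ , d-det , a≈) =
    trans (a≈ t) (sumFin-zero n λ l → sumBelow-zero t λ y y≤t →
      trans (*-congˡ (Det-negligible (d-det l) (negligible (t ∸ₑ y) (∸ₑ-≤ₑ t y)))) (zeroʳ _))

  InXYA-negligible : ∀ {p t} → (∀ u → u ≤ₑ t → u ≢ t → Negligible u) → InXYA k ζ p → p t ≈ 0#
  InXYA-negligible {t = t} negligible (n , g , a , g∈XY , a∈A , p≈) =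
    trans (p≈ t) (sumFin-zero n λ l → sumBelow-zero t λ x x≤t → term l x x≤t)
    where
    term : ∀ l x → x ≤ₑ t → g l x · a l (t ∸ₑ x) ≈ 0#
    term l x x≤t with x ≟ₑ 0ₑ
    ... | yes ≡.refl = trans (*-congʳ (proj₂ (g∈XY l))) (zeroˡ _)
    ... | no  x≢0    = trans (*-congˡ (InA-negligible below (a∈A l))) (zeroʳ _)
      where
      below : ∀ u → u ≤ₑ t ∸ₑ x → Negligible u
      below u u≤t∸x = negligible u (≤ₑ-trans u≤t∸x (∸ₑ-≤ₑ t x))
                                   λ { ≡.refl → x≢0 (≤ₑ-∸ₑ⇒0ₑ x≤t u≤t∸x) }

  -- Exponents whose alternants are the minimal generators of 𝒜: z₁^a w₁^b with a + b = k (polarisations of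
  -- z₁^k - z₂^k) and z₁ w₂ (z₁ w₂ - z₂ w₁ is a multiple of x₁ y₂ - x₂ y₁).
  data Generator : Exp → Set where
    pure  : ∀ {a b} → a + b ≡ k → Generator (exp a 0 b 0)
    mixed : Generator (exp 1 0 0 1)

  Generator-∣wt : ∀ {t} → Generator t → k ∣ wt t
  Generator-∣wt (pure {a} {b} a+b≡k) = ≡.subst (k ∣_) (≡.trans (≡.sym a+b≡k) (≡.sym (wt-pure a b))) (n∣n {k})
  Generator-∣wt mixed                = k∣1+[k-1]

  Generator-negligible : ∀ {t} → Generator t → ∀ u → u ≤ₑ t → u ≢ t → Negligible u
  Generator-negligible (pure {a} {b} a+b≡k) (exp u₁ _ u₃ _) (u₁≤a , z≤n , u₃≤b , z≤n) u≢t with u₁ + u₃ ≟ 0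
  ... | yes u₁+u₃≡0 = inj₁ (exp-cong (ℕ.m+n≡0⇒m≡0 u₁ u₁+u₃≡0) ≡.refl (ℕ.m+n≡0⇒n≡0 u₁ u₁+u₃≡0) ≡.refl)
  ... | no  u₁+u₃≢0 = inj₂ (≡.subst (λ m → ¬ k ∣ m) (≡.sym (wt-pure u₁ u₃)) (∤-small (ℕ.n≢0⇒n>0 u₁+u₃≢0) u₁+u₃<k))
    where
    u₁+u₃<k : u₁ + u₃ < k
    u₁+u₃<k with u₁ ≟ a | u₃ ≟ b
    ... | yes ≡.refl | yes ≡.refl = ⊥-elim (u≢t ≡.refl)
    ... | no  u₁≢a   | _          = ≡.subst (u₁ + u₃ <_) a+b≡k (ℕ.+-mono-<-≤ (ℕ.≤∧≢⇒< u₁≤a u₁≢a) u₃≤b)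
    ... | yes _      | no  u₃≢b   = ≡.subst (u₁ + u₃ <_) a+b≡k (ℕ.+-mono-≤-< u₁≤a (ℕ.≤∧≢⇒< u₃≤b u₃≢b))
  Generator-negligible mixed (exp 0 0 0 0) _ _ = inj₁ ≡.refl
  Generator-negligible mixed (exp 1 0 0 0) _ _ =
    inj₂ (≡.subst (λ m → ¬ k ∣ m) (≡.sym (wt-pure 1 0)) (∤-small (s≤s z≤n) (s≤s (s≤s z≤n))))
  Generator-negligible mixed (exp 0 0 0 1) _ _ =
    inj₂ (≡.subst (λ m → ¬ k ∣ m) (≡.sym (ℕ.*-identityʳ (suc k′))) (∤-small (s≤s z≤n) ℕ.≤-refl))
  Generator-negligible mixed (exp 1 0 0 1) _ u≢t = ⊥-elim (u≢t ≡.refl)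
  Generator-negligible mixed (exp (suc (suc _)) _ _ _) (s≤s () , _) _
  Generator-negligible mixed (exp _ (suc _) _ _) (_ , () , _) _
  Generator-negligible mixed (exp _ _ (suc _) _) (_ , _ , () , _) _
  Generator-negligible mixed (exp _ _ _ (suc (suc _))) (_ , _ , _ , s≤s ()) _

  Generator-swapE : ∀ {t t′} → Generator t → Generator t′ → swapE t ≢ t′
  Generator-swapE (pure ()) (pure _) ≡.refl
  Generator-swapE (pure _)  mixed    ()
  Generator-swapE mixed     (pure _) ()
  Generator-swapE mixed     mixed    ()

  Generator-bidegree : ∀ {t i j} → Generator t → xdeg t ≡ i → ydeg t ≡ j →
                       (i + j ≡ k × t ≡ exp i 0 j 0) ⊎ ((i ≡ 1 × j ≡ 1) × t ≡ exp 1 0 0 1)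
  Generator-bidegree (pure {a} {b} a+b≡k) ≡.refl ≡.refl =
    inj₁ (≡.trans (≡.cong₂ _+_ (ℕ.+-identityʳ a) (ℕ.+-identityʳ b)) a+b≡k ,
          exp-cong (≡.sym (ℕ.+-identityʳ a)) ≡.refl (≡.sym (ℕ.+-identityʳ b)) ≡.refl)
  Generator-bidegree mixed ≡.refl ≡.refl = inj₂ ((≡.refl , ≡.refl) , ≡.refl)

  module Spanning (i j : ℕ) {r} (basis : Fin r → Exp)
                  (complete : ∀ {t} → Generator t → xdeg t ≡ i → ydeg t ≡ j → ∃ λ l → basis l ≡ t) where

    Good : Fun → Set (c ⊔ ℓ)
    Good p = ∃ λ cs → InXYA k ζ (λ e → p e ⊝ lincomb r cs (Alt ∘ basis) e)

    InXYA⇒Good : ∀ {p} → InXYA k ζ p → Good p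
    InXYA⇒Good p∈XYA = (λ _ → 0#) ,
      ≈-closed InXYA-subspace (λ e → sym (trans (+-congˡ (-‿cong (lincomb-zero r (Alt ∘ basis) e))) (x⊝0≈x _))) p∈XYA

    Good-subspace : IsSubspace Good
    Good-subspace = record
      { ≈-closed = λ { p≈q (cs , p-rest) → cs , ≈-closed InXYA-subspace (λ e → +-congʳ (p≈q e)) p-rest }
      ; 0-closed = InXYA⇒Good (0-closed InXYA-subspace)
      ; ⊕-closed = λ { (cs , p-rest) (cs′ , q-rest) → (λ l → cs l ⊕ cs′ l) ,
          ≈-closed InXYA-subspace
            (λ e → sym (trans (+-congˡ (-‿cong (lincomb-⊕ r cs cs′ (Alt ∘ basis) e))) (⊝-distrib-⊕ _ _ _ _)))
            (⊕-closed InXYA-subspace p-rest q-rest) }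
      ; ·-closed = λ { x (cs , p-rest) → (λ l → x · cs l) ,
          ≈-closed InXYA-subspace
            (λ e → sym (trans (+-congˡ (-‿cong (lincomb-· r x cs (Alt ∘ basis) e))) (sym (x[y-z]≈xy-xz x _ _))))
            (·-closed InXYA-subspace x p-rest) }
      }

    Good-basis : ∀ l → Good (Alt (basis l))
    Good-basis l = (λ l′ → indicator (does (l′ Finₚ.≟ l))) ,
      ≈-closed InXYA-subspace (λ e → sym (trans (+-congˡ (-‿cong (lincomb-unit r (Alt ∘ basis) l e))) (-‿inverseʳ _)))
               (0-closed InXYA-subspace)

    Good-Generator : ∀ {t} → Generator t → xdeg t ≡ i → ydeg t ≡ j → Good (Alt t)
    Good-Generator t-gen xt yt with complete t-gen xt yt
    ... | l , ≡.refl = Good-basis l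

    Good-Alt-symmetric : ∀ {s} → swapE s ≡ s → Good (Alt s)
    Good-Alt-symmetric {s} s-symmetric = ≈-closed Good-subspace
      (λ e → sym (trans (+-congˡ (-‿cong (reflexive (≡.cong (λ u → δ u e) s-symmetric)))) (-‿inverseʳ _)))
      (0-closed Good-subspace)

    Good-Alt-swapE : ∀ {s} → Good (Alt (swapE s)) → Good (Alt s)
    Good-Alt-swapE {s} good = ≈-closed Good-subspace
      (λ e → trans (-1*x≈-x _) (trans (-‿cong (Alt-swapE s e)) (-‿involutive _)))
      (·-closed Good-subspace (⊖ 1#) good)

    Good-Alt-+ₑ : ∀ {s t} → s ≢ 0ₑ → k ∣ wt s → k ∣ wt (s +ₑ t) → (t ≡ 0ₑ → Good (Alt s)) → Good (Alt (s +ₑ t))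
    Good-Alt-+ₑ {s} {t} s≢0 k∣s k∣s+t t≡0⇒good with t ≟ₑ 0ₑ
    ... | yes ≡.refl = ≡.subst (Good ∘ Alt) (≡.sym (+ₑ-identityʳ s)) (t≡0⇒good ≡.refl)
    ... | no  t≢0    = InXYA⇒Good (Alt-+ₑ-∈XYA s≢0 t≢0 k∣s (∣wt-+ₑ-cancel s t k∣s k∣s+t))

    Good-Alt-mixed : ∀ x y → xdeg (exp (suc x) 0 0 (suc y)) ≡ i → ydeg (exp (suc x) 0 0 (suc y)) ≡ j →
                     k ∣ wt (exp (suc x) 0 0 (suc y)) → Good (Alt (exp (suc x) 0 0 (suc y)))
    Good-Alt-mixed x y xs ys k∣s =
      Good-Alt-+ₑ {exp 1 0 0 1} {exp x 0 0 y} (λ ()) k∣1+[k-1] k∣s λ { ≡.refl → Good-Generator mixed xs ys }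

    Good-Alt-pure : ∀ a b → xdeg (exp a 0 b 0) ≡ i → ydeg (exp a 0 b 0) ≡ j →
                    k ∣ wt (exp a 0 b 0) → Good (Alt (exp a 0 b 0))
    Good-Alt-pure a b xs ys k∣s with a + b ≟ 0
    ... | yes a+b≡0 = Good-Alt-symmetric (exp-cong (≡.sym a≡0) a≡0 (≡.sym b≡0) b≡0)
      where
      a≡0 : a ≡ 0
      a≡0 = ℕ.m+n≡0⇒m≡0 a a+b≡0
      b≡0 : b ≡ 0
      b≡0 = ℕ.m+n≡0⇒n≡0 a a+b≡0
    ... | no  a+b≢0 with ≤-+-split a b (∣⇒≤ {{≢-nonZero a+b≢0}} (≡.subst (k ∣_) (wt-pure a b) k∣s))
    ...   | a′ , b′ , a′≤a , b′≤b , a′+b′≡k =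
      ≡.subst (Good ∘ Alt) (+ₑ-∸ₑ s′≤s)
        (Good-Alt-+ₑ {s′} {exp a 0 b 0 ∸ₑ s′} s′≢0 (Generator-∣wt (pure {a′} {b′} a′+b′≡k))
                     (≡.subst (λ u → k ∣ wt u) (≡.sym (+ₑ-∸ₑ s′≤s)) k∣s) s′-good)
      where
      s′ : Exp
      s′ = exp a′ 0 b′ 0
      s′≤s : s′ ≤ₑ exp a 0 b 0
      s′≤s = a′≤a , z≤n , b′≤b , z≤n
      s′≢0 : s′ ≢ 0ₑ
      s′≢0 s′≡0 = ℕ.0≢1+n (≡.trans (≡.sym (≡.cong₂ _+_ (≡.cong a₁ s′≡0) (≡.cong b₁ s′≡0))) a′+b′≡k)
      s′-good : exp a 0 b 0 ∸ₑ s′ ≡ 0ₑ → Good (Alt s′)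
      s′-good rest≡0 = Good-Generator (pure {a′} {b′} a′+b′≡k)
                         (≡.trans (≡.cong (_+ 0) (≡.sym (same a′≤a (≡.cong a₁ rest≡0)))) xs)
                         (≡.trans (≡.cong (_+ 0) (≡.sym (same b′≤b (≡.cong b₁ rest≡0)))) ys)
        where
        same : ∀ {m n} → m ≤ n → n ∸ m ≡ 0 → n ≡ m
        same m≤n n∸m≡0 = ℕ.≤-antisym (ℕ.m∸n≡0⇒m≤n n∸m≡0) m≤n

    Good-Alt : ∀ s → xdeg s ≡ i → ydeg s ≡ j → k ∣ wt s → Good (Alt s)
    Good-Alt (exp (suc x) (suc y) c d) _ _ k∣s =
      Good-Alt-+ₑ {exp 1 1 0 0} {exp x y c d} (λ ()) k∣1+[k-1] k∣s λ _ → Good-Alt-symmetric ≡.refl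
    Good-Alt (exp a b (suc x) (suc y)) _ _ k∣s =
      Good-Alt-+ₑ {exp 0 0 1 1} {exp a b x y} (λ ()) k∣1+[k-1] k∣s λ _ → Good-Alt-symmetric ≡.refl
    Good-Alt (exp (suc x) 0 0 (suc y)) xs ys k∣s = Good-Alt-mixed x y xs ys k∣s
    Good-Alt s@(exp 0 (suc x) (suc y) 0) xs ys k∣s = Good-Alt-swapE
      (Good-Alt-mixed x y (≡.trans (xdeg-swapE s) xs) (≡.trans (ydeg-swapE s) ys) (∣wt-swapE s k∣s))
    Good-Alt (exp a 0 b 0) xs ys k∣s = Good-Alt-pure a b xs ys k∣s
    Good-Alt s@(exp 0 a 0 b) xs ys k∣s = Good-Alt-swapE
      (Good-Alt-pure a b (≡.trans (xdeg-swapE s) xs) (≡.trans (ydeg-swapE s) ys) (∣wt-swapE s k∣s))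

    Good-Det : ∀ {B} → Det B → Bihom i j B → Good B
    Good-Det {B} B-det@((N , B-bounded) , _) B-bihom =
      ≈-closed Good-subspace (Det-alternant-expansion B-bounded B-det)
               (sumBelow-closed Good-subspace (box N) _ term)
      where
      vanishing : ∀ s → B s ≈ 0# → Good (λ e → (½ · B s) · Alt s e)
      vanishing s Bs≈0 = ≈-closed Good-subspace (λ e → sym (trans (*-congʳ (trans (*-congˡ Bs≈0) (zeroʳ ½))) (zeroˡ _)))
                                  (0-closed Good-subspace)
      term : ∀ s → Good (λ e → (½ · B s) · Alt s e)
      term s with xdeg s ≟ i ×-dec ydeg s ≟ j | k ∣? wt s
      ... | yes (xs , ys) | yes k∣s = ·-closed Good-subspace (½ · B s) (Good-Alt s xs ys k∣s)
      ... | no  wrong     | _       = vanishing s (B-bihom s wrong)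
      ... | yes _         | no  k∤s = vanishing s (Det-∤wt B-det k∤s)

    Good-restrict-⋆ : ∀ {f d} → Finite f → Det d → Good (restrict (isBidegree i j) (f ⋆ d))
    Good-restrict-⋆ {f} {d} (N , f-bounded) d-det =
      ≈-closed Good-subspace expansion
               (sumBelow-closed Good-subspace (box N) _ λ s → ·-closed Good-subspace (f s) (Good-δ⋆ s))
      where
      b : ℕ → ℕ → Bool
      b = isBidegree i j
      Good-δ⋆ : ∀ s → Good (δ s ⋆ restrict (shift s b) d)
      Good-δ⋆ s with s ≟ₑ 0ₑ
      ... | yes ≡.refl = ≈-closed Good-subspace (λ e → sym (δ⋆-≤ₑ 0ₑ (restrict b d) (0ₑ-≤ₑ e)))
                                  (Good-Det (Det-restrict b d-det) (Bihom-restrict i j d))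
      ... | no  s≢0    = InXYA⇒Good (InXYA-⋆ (InXY-δ s≢0) (InA-Det (Det-restrict (shift s b) d-det)))
      expansion : ∀ e → sumBelow (box N) (λ s → f s · (δ s ⋆ restrict (shift s b) d) e) ≈ restrict b (f ⋆ d) e
      expansion e = begin
        sumBelow (box N) (λ s → f s · (δ s ⋆ restrict (shift s b) d) e)
          ≈⟨ sumBelow-cong (box N) (λ s _ → *-congˡ (restrict-δ⋆ b s d e)) ⟨
        sumBelow (box N) (λ s → f s · (indicator (b (xdeg e) (ydeg e)) · (δ s ⋆ d) e))
          ≈⟨ sumBelow-cong (box N) (λ s _ → x∙yz≈y∙xz (f s) _ _) ⟩
        sumBelow (box N) (λ s → indicator (b (xdeg e) (ydeg e)) · (f s · (δ s ⋆ d) e))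
          ≈⟨ sumBelow-·ˡ (box N) _ _ ⟩
        indicator (b (xdeg e) (ydeg e)) · sumBelow (box N) (λ s → f s · (δ s ⋆ d) e)
          ≈⟨ *-congˡ (⋆-expandˡ f-bounded d e) ⟨
        restrict b (f ⋆ d) e ∎

    Good-InA : ∀ {p} → InA k ζ p → Bihom i j p → Good p
    Good-InA {p} (n , f , d , f-finite , d-det , p≈) p-bihom =
      ≈-closed Good-subspace restricted≈p
               (sumFin-closed Good-subspace n _ λ l → Good-restrict-⋆ (f-finite l) (d-det l))
      where
      restricted≈p : ∀ e → sumFin n (λ l → restrict (isBidegree i j) (f l ⋆ d l) e) ≈ p e
      restricted≈p e = begin
        sumFin n (λ l → restrict (isBidegree i j) (f l ⋆ d l) e)  ≈⟨ sumFin-·ˡ n (indicator bidegree-e) _ ⟩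
        indicator bidegree-e · sumFin n (λ l → (f l ⋆ d l) e)     ≈⟨ *-congˡ (p≈ e) ⟨
        restrict (isBidegree i j) p e                             ≈⟨ restrict-Bihom p-bihom e ⟩
        p e                                                       ∎
        where
        bidegree-e : Bool
        bidegree-e = isBidegree i j (xdeg e) (ydeg e)

    quotDim : (∀ l → Generator (basis l)) → (∀ l → xdeg (basis l) ≡ i × ydeg (basis l) ≡ j) →
              (∀ {l l′} → basis l ≡ basis l′ → l ≡ l′) → QuotDim (A-comp k ζ i j) (XYA-comp k ζ i j) r
    quotDim generator bidegree injective = Alt ∘ basis , members , independent , spanning
      where
      members : ∀ l → A-comp k ζ i j (Alt (basis l))
      members l = InA-Det (Det-Alt (Generator-∣wt (generator l))) , Bihom-Alt (bidegree l)

      Alt-basis : ∀ l′ l → Alt (basis l′) (basis l) ≈ indicator (does (l′ Finₚ.≟ l))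
      Alt-basis l′ l with l′ Finₚ.≟ l
      ... | yes ≡.refl =
        trans (+-congʳ (δ-diag (basis l)))
              (trans (+-congˡ (-‿cong (δ-off (Generator-swapE (generator l) (generator l))))) (x⊝0≈x 1#))
      ... | no  l′≢l   =
        trans (+-cong (δ-off (l′≢l ∘ injective)) (-‿cong (δ-off (Generator-swapE (generator l′) (generator l)))))
              0⊝0≈0

      independent : ∀ cs → XYA-comp k ζ i j (lincomb r cs (Alt ∘ basis)) → ∀ l → cs l ≈ 0#
      independent cs (∈XYA , _) l = begin
        cs l
          ≈⟨ lincomb-unit r (λ l′ _ → cs l′) l (basis l) ⟨
        sumFin r (λ l′ → indicator (does (l′ Finₚ.≟ l)) · cs l′)
          ≈⟨ sumFin-cong r (λ l′ → trans (*-comm _ (cs l′)) (*-congˡ (sym (Alt-basis l′ l)))) ⟩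
        lincomb r cs (Alt ∘ basis) (basis l)
          ≈⟨ InXYA-negligible (Generator-negligible (generator l)) ∈XYA ⟩
        0# ∎

      lincomb-bihom : ∀ cs → Bihom i j (lincomb r cs (Alt ∘ basis))
      lincomb-bihom cs = sumFin-closed (Bihom-subspace i j) r (λ l e → cs l · Alt (basis l) e)
                                       λ l → ·-closed (Bihom-subspace i j) (cs l) (Bihom-Alt (bidegree l))

      spanning : ∀ p → A-comp k ζ i j p → ∃ λ cs → XYA-comp k ζ i j (λ e → p e ⊝ lincomb r cs (Alt ∘ basis) e)
      spanning p (p∈A , p-bihom) = cs , rest∈XYA , λ e wrong →
        trans (+-cong (p-bihom e wrong) (-‿cong (lincomb-bihom cs e wrong))) 0⊝0≈0
        where
        cs : Fin r → K
        cs = proj₁ (Good-InA p∈A p-bihom)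
        rest∈XYA : InXYA k ζ (λ e → p e ⊝ lincomb r cs (Alt ∘ basis) e)
        rest∈XYA = proj₂ (Good-InA p∈A p-bihom)

  dimension : ∀ i j {x y} → Reflects (i + j ≡ k) x → Reflects (i ≡ 1 × j ≡ 1) y →
              QuotDim (A-comp k ζ i j) (XYA-comp k ζ i j) ((if x then 1 else 0) + (if y then 1 else 0))
  dimension i j (ofʸ i+j≡k) (ofʸ (≡.refl , ≡.refl)) =
    Spanning.quotDim 1 1 basis complete generator bidegree injective
    where
    basis : Fin 2 → Exp
    basis Fin.zero    = exp 1 0 1 0
    basis (Fin.suc _) = exp 1 0 0 1
    complete : ∀ {t} → Generator t → xdeg t ≡ 1 → ydeg t ≡ 1 → ∃ λ l → basis l ≡ t
    complete t-gen xt yt with Generator-bidegree t-gen xt yt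
    ... | inj₁ (_ , t≡) = Fin.zero , ≡.sym t≡
    ... | inj₂ (_ , t≡) = Fin.suc Fin.zero , ≡.sym t≡
    generator : ∀ l → Generator (basis l)
    generator Fin.zero    = pure i+j≡k
    generator (Fin.suc _) = mixed
    bidegree : ∀ l → xdeg (basis l) ≡ 1 × ydeg (basis l) ≡ 1
    bidegree Fin.zero    = ≡.refl , ≡.refl
    bidegree (Fin.suc _) = ≡.refl , ≡.refl
    injective : ∀ {l l′} → basis l ≡ basis l′ → l ≡ l′
    injective {Fin.zero}           {Fin.zero}           _ = ≡.refl
    injective {Fin.suc Fin.zero}   {Fin.suc Fin.zero}   _ = ≡.refl
  dimension i j (ofʸ i+j≡k) (ofⁿ ¬i≡j≡1) =
    Spanning.quotDim i j (λ _ → exp i 0 j 0) complete (λ _ → pure i+j≡k)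
                     (λ _ → ℕ.+-identityʳ i , ℕ.+-identityʳ j) λ { {Fin.zero} {Fin.zero} _ → ≡.refl }
    where
    complete : ∀ {t} → Generator t → xdeg t ≡ i → ydeg t ≡ j → ∃ λ (l : Fin 1) → exp i 0 j 0 ≡ t
    complete t-gen xt yt with Generator-bidegree t-gen xt yt
    ... | inj₁ (_ , t≡)     = Fin.zero , ≡.sym t≡
    ... | inj₂ (i≡j≡1 , _)  = ⊥-elim (¬i≡j≡1 i≡j≡1)
  dimension i j (ofⁿ i+j≢k) (ofʸ (≡.refl , ≡.refl)) =
    Spanning.quotDim 1 1 (λ _ → exp 1 0 0 1) complete (λ _ → mixed)
                     (λ _ → ≡.refl , ≡.refl) λ { {Fin.zero} {Fin.zero} _ → ≡.refl }
    where
    complete : ∀ {t} → Generator t → xdeg t ≡ 1 → ydeg t ≡ 1 → ∃ λ (l : Fin 1) → exp 1 0 0 1 ≡ t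
    complete t-gen xt yt with Generator-bidegree t-gen xt yt
    ... | inj₁ (i+j≡k , _) = ⊥-elim (i+j≢k i+j≡k)
    ... | inj₂ (_ , t≡)    = Fin.zero , ≡.sym t≡
  dimension i j (ofⁿ i+j≢k) (ofⁿ ¬i≡j≡1) =
    Spanning.quotDim i j basis complete (λ ()) (λ ()) λ { {()} }
    where
    basis : Fin 0 → Exp
    basis ()
    complete : ∀ {t} → Generator t → xdeg t ≡ i → ydeg t ≡ j → ∃ λ l → basis l ≡ t
    complete t-gen xt yt with Generator-bidegree t-gen xt yt
    ... | inj₁ (i+j≡k , _) = ⊥-elim (i+j≢k i+j≡k)
    ... | inj₂ (i≡j≡1 , _) = ⊥-elim (¬i≡j≡1 i≡j≡1)

corollary3 : {c ℓ : Level} (R : CommutativeRing c ℓ) →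
    Over.IsField R → Over.CharZero R →
    (k : ℕ) → 2 ≤ k → (ζ : CommutativeRing.Carrier R) → Over.PrimitiveRoot R k ζ →
    (i j : ℕ) → Over.CatCoeffIs R k ζ i j (catCoeff k i j)
corollary3 R isField char0 zero          ()       ζ ζ-primitive i j
corollary3 R isField char0 (suc zero)    (s≤s ()) ζ ζ-primitive i j
corollary3 R isField char0 (suc (suc k′)) _ ζ ζ-primitive i j =
  Dihedral.dimension R isField char0 k′ ζ ζ-primitive i j
    (proof (i + j ≟ suc (suc k′))) (proof (i ≟ 1) ×-reflects proof (j ≟ 1))
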